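{- Let $\mathbb{I}([0,1])$ denote the set of closed subintervals of $[0,1]$, let $n\ge 1$, and let $G: \mathbb{I}([0,1])^2 \to \mathbb{I}([0,1])$ be a function. Suppose $F: \mathbb{I}([0,1])^n \to \mathbb{I}([0,1])$ satisfies $$F\big(G(\Lambda,X_1),\ldots,G(\Lambda,X_n)\big)=G\big(\Lambda,F(X_1,\ldots,X_n)\big)\quad\text{for all }\Lambda,X_1,\ldots,X_n\in\mathbb{I}([0,1]),$$ and suppose there exists $A\in\mathbb{I}([0,1])$ such that $F(A,\ldots,A)=A$ and the map $G_A:\mathbb{I}([0,1])\to\mathbb{I}([0,1])$, $G_A(X)=G(X,A)$, is a bijection. Then $F$ is idempotent, i.e. $F(X,\ldots,X)=X$ for all $X\in\mathbb{I}([0,1])$.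
   Context: $\mathbb{I}([0,1])=\{[a,b] : 0\le a\le b\le 1\}$. -}

module Defs where

-- Closed subintervals [a,b] of [0,1] over an ordered carrier R
-- (R = the reals in the paper; no reals in agda-stdlib, so R is abstract).
-- The order-proofs are irrelevant, so two intervals are equal (≡)
-- exactly when their endpoints are equal, i.e. equality as sets.
record Interval {R : Set} (_≤_ : R → R → Set) (zero one : R) : Set where
  constructor [_,_]
  field
    lo : R
    hi : R
    .0≤lo  : zero ≤ lo
    .lo≤hi : lo ≤ hi
    .hi≤1  : hi ≤ one

-- Every X is G Λ A for some Λ, and the diagonal of F commutes with G Λ, so
-- F (X,…,X) = F (G Λ A,…,G Λ A) = G Λ (F (A,…,A)) = G Λ A = X.
module Submission where

open import Defs
open import Data.Nat using (ℕ; _≥_)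
open import Data.Fin using (Fin)
open import Relation.Binary.PropositionalEquality using (_≡_; refl; cong; module ≡-Reasoning)
open import Function.Definitions using (Bijective; Surjective)
open import Data.Product using (∃; _×_; _,_)

module _ {I T : Set} (F : (I → T) → T) (G : T → T → T) where

  diagonal-fixed-on-orbit : (∀ Λ X → F (λ i → G Λ (X i)) ≡ G Λ (F X))
    → ∀ {A} → F (λ _ → A) ≡ A → ∀ Λ → F (λ _ → G Λ A) ≡ G Λ A
  diagonal-fixed-on-orbit comm {A} FA≡A Λ = begin
    F (λ _ → G Λ A)   ≡⟨ comm Λ (λ _ → A) ⟩
    G Λ (F (λ _ → A)) ≡⟨ cong (G Λ) FA≡A ⟩
    G Λ A             ∎
    where open ≡-Reasoning

  idempotent-of-surjective-orbit : (∀ Λ X → F (λ i → G Λ (X i)) ≡ G Λ (F X))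
    → ∀ {A} → F (λ _ → A) ≡ A → Surjective _≡_ _≡_ (λ Λ → G Λ A)
    → ∀ X → F (λ _ → X) ≡ X
  idempotent-of-surjective-orbit comm FA≡A surj X with surj X
  ... | Λ , GΛA≡X with GΛA≡X refl
  ... | refl = diagonal-fixed-on-orbit comm FA≡A Λ

mainTheorem2 : (R : Set) (_≤_ : R → R → Set) (zero one : R)
    → (n : ℕ) → n ≥ 1
    → (G : Interval _≤_ zero one → Interval _≤_ zero one → Interval _≤_ zero one)
    → (F : (Fin n → Interval _≤_ zero one) → Interval _≤_ zero one)
    → (∀ (Λ : Interval _≤_ zero one) (X : Fin n → Interval _≤_ zero one)
         → F (λ i → G Λ (X i)) ≡ G Λ (F X))
    → (∃ λ (A : Interval _≤_ zero one) → (F (λ _ → A) ≡ A) × Bijective _≡_ _≡_ (λ X → G X A))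
    → ∀ (X : Interval _≤_ zero one) → F (λ _ → X) ≡ X
mainTheorem2 R _≤_ zero one n _ G F comm (A , FA≡A , _ , surj) =
  idempotent-of-surjective-orbit F G comm FA≡A surj
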